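{- Let $n \geq 3$ and let $T_n = \{k : 2 \leq k \leq n-1,\ k \equiv n+1 \pmod 2\}$ (so $T_n = \{3,5,\ldots,n-1\}$ if $n$ is even and $T_n = \{2,4,\ldots,n-1\}$ if $n$ is odd). Let $i,j \in T_n$ with $i \neq j$, and let $\pi \in \mathfrak{B}_n$ satisfy $\mathrm{altruns}_B(\mathrm{Sgn\_flip}_i(\pi)) = \mathrm{altruns}_B(\pi) + 1$. Then $\mathrm{altruns}_B(\mathrm{Sgn\_flip}_j(\mathrm{Sgn\_flip}_i(\pi))) = \mathrm{altruns}_B(\mathrm{Sgn\_flip}_j(\pi)) + 1$.
   Context: $\mathfrak{B}_n$ is the set of signed permutations of $[n]$, written as words $\pi = \pi_1,\ldots,\pi_n$ with $\pi_i \in \{\pm 1,\ldots,\pm n\}$ and $|\pi_1|,\ldots,|\pi_n|$ a permutation of $[n]$; $\overline{a}$ denotes $-a$. Set $\pi_0 = 0$. For $1 \leq i \leq n-1$, $\pi$ changes direction at $i$ if $\pi_{i-1} < \pi_i > \pi_{i+1}$ or $\pi_{i-1} > \pi_i < \pi_{i+1}$. $\mathrm{altruns}_B(\pi)$ is $1$ plus the number of indices at which $\pi$ changes direction. For $1 \leq k \leq n$, $\mathrm{Sgn\_flip}_k(\pi) = \pi_1,\ldots,\pi_{k-1},\overline{\pi_k},\ldots,\overline{\pi_n}$. -}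

module Defs where

open import Data.Nat using (ℕ; zero; suc; _+_; _∸_; _≤_; _<_; _%_)
open import Data.Integer as ℤ using (ℤ; ∣_∣; -_; +_)
open import Data.List using (List; []; _∷_; length; map; take; drop; _++_; upTo)
open import Data.List.Relation.Binary.Permutation.Propositional using (_↭_)
open import Data.Product using (_×_)
open import Data.Sum using (_⊎_)
open import Relation.Binary.PropositionalEquality using (_≡_)
open import Relation.Nullary using (Dec; yes; no)
open import Relation.Nullary.Decidable using (⌊_⌋)
open import Data.Bool using (Bool; true; false; _∧_; _∨_; if_then_else_)

IsSignedPerm : ℕ → List ℤ → Set
IsSignedPerm n π = map ∣_∣ π ↭ map suc (upTo n)

changesDir : ℤ → ℤ → ℤ → Bool
changesDir a b c =
  (⌊ a ℤ.<? b ⌋ ∧ ⌊ c ℤ.<? b ⌋) ∨ (⌊ b ℤ.<? a ⌋ ∧ ⌊ b ℤ.<? c ⌋)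

countChanges : List ℤ → ℕ
countChanges (a ∷ b ∷ c ∷ rest) =
  (if changesDir a b c then 1 else 0) + countChanges (b ∷ c ∷ rest)
countChanges _ = 0

-- altruns_B(π): with π₀ = 0, the consecutive triples of 0,π₁,…,πₙ are
-- exactly (π_{i-1},π_i,π_{i+1}) for 1 ≤ i ≤ n-1.
altrunsB : List ℤ → ℕ
altrunsB π = 1 + countChanges (+ 0 ∷ π)

-- Sgn_flip_k(π) = π₁,…,π_{k-1}, -π_k,…,-π_n   (k is 1-based)
sgnFlip : ℕ → List ℤ → List ℤ
sgnFlip k π = take (k ∸ 1) π ++ map -_ (drop (k ∸ 1) π)

InT : ℕ → ℕ → Set
InT n k = (2 ≤ k) × (k ≤ n ∸ 1) × (k % 2 ≡ (n + 1) % 2)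

-- Flipping the signs of a suffix changes only the two direction tests that straddle
-- the cut, since a triple lying entirely in the negated part keeps its turn (negation
-- swaps peaks and valleys). With π₀ = 0 prepended, Sgn_flip_k negates the suffix
-- starting at position k, so it affects only the tests centred at k-1 and k. For
-- distinct i, j of the same parity these pairs are disjoint, so the two flips
-- contribute independently to altruns_B and the increment caused by Sgn_flip_i is
-- unaffected by a prior Sgn_flip_j.
module Submission where

open import Defs
open import Data.Nat using (ℕ; zero; suc; _+_; _≤_; _%_; s≤s; z≤n)
open import Data.Nat.Properties
  using (+-comm; +-assoc; ≤-trans; m≤n+m; suc-injective; +-cancelʳ-≡; +-commutativeSemigroup)
open import Algebra.Properties.CommutativeSemigroup +-commutativeSemigroup
  using (interchange)
open import Data.Integer using (ℤ; -_; 0ℤ)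
import Data.Integer as ℤ
open import Data.Integer.Properties using (neg-mono-<; neg-cancel-<)
open import Data.List using (List; []; _∷_; length; map; take; drop; _++_)
open import Data.Bool using (if_then_else_; _∧_)
open import Data.Bool.Properties using (∨-comm)
open import Data.Product using (_,_)
open import Data.Sum using (_⊎_; inj₁; inj₂)
import Data.Sum as Sum
open import Data.Empty using (⊥-elim)
open import Function using (_∘_; mk⇔)
open import Relation.Nullary.Decidable using (⌊_⌋; isYes≗does; does-⇔)
open import Relation.Binary.PropositionalEquality
  using (_≡_; _≢_; refl; sym; trans; cong; cong₂; module ≡-Reasoning)

-- Sgn_flip_k π is flipFrom (k ∸ 1) π, and x ∷ flipFrom k π is flipFrom (suc k) (x ∷ π),
-- both definitionally.
flipFrom : ℕ → List ℤ → List ℤ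
flipFrom k xs = take k xs ++ map -_ (drop k xs)

flipFrom-neg : ∀ k xs → flipFrom k (map -_ xs) ≡ map -_ (flipFrom k xs)
flipFrom-neg zero    xs       = refl
flipFrom-neg (suc k) []       = refl
flipFrom-neg (suc k) (x ∷ xs) = cong (- x ∷_) (flipFrom-neg k xs)

flipFrom-comm : ∀ i j xs → flipFrom i (flipFrom j xs) ≡ flipFrom j (flipFrom i xs)
flipFrom-comm zero    zero    xs       = refl
flipFrom-comm zero    (suc j) xs       = sym (flipFrom-neg (suc j) xs)
flipFrom-comm (suc i) zero    xs       = flipFrom-neg (suc i) xs
flipFrom-comm (suc i) (suc j) []       = refl
flipFrom-comm (suc i) (suc j) (x ∷ xs) = cong (x ∷_) (flipFrom-comm i j xs)

⌊neg<?neg⌋ : ∀ a b → ⌊ - a ℤ.<? - b ⌋ ≡ ⌊ b ℤ.<? a ⌋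
⌊neg<?neg⌋ a b = begin
  ⌊ - a ℤ.<? - b ⌋ ≡⟨ isYes≗does (- a ℤ.<? - b) ⟩
  _                ≡⟨ does-⇔ (mk⇔ neg-cancel-< neg-mono-<) (- a ℤ.<? - b) (b ℤ.<? a) ⟩
  _                ≡⟨ isYes≗does (b ℤ.<? a) ⟨
  ⌊ b ℤ.<? a ⌋     ∎
  where open ≡-Reasoning

changesDir-neg : ∀ a b c → changesDir (- a) (- b) (- c) ≡ changesDir a b c
changesDir-neg a b c
  rewrite ⌊neg<?neg⌋ a b | ⌊neg<?neg⌋ c b | ⌊neg<?neg⌋ b a | ⌊neg<?neg⌋ b c =
  ∨-comm (⌊ b ℤ.<? a ⌋ ∧ ⌊ b ℤ.<? c ⌋) (⌊ a ℤ.<? b ⌋ ∧ ⌊ c ℤ.<? b ⌋)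

countChanges-neg : ∀ xs → countChanges (map -_ xs) ≡ countChanges xs
countChanges-neg []              = refl
countChanges-neg (a ∷ [])        = refl
countChanges-neg (a ∷ b ∷ [])    = refl
countChanges-neg (a ∷ b ∷ c ∷ r) =
  cong₂ _+_ (cong (λ t → if t then 1 else 0) (changesDir-neg a b c))
            (countChanges-neg (b ∷ c ∷ r))

firstChange : ℤ → List ℤ → ℕ
firstChange x (y ∷ z ∷ _) = if changesDir x y z then 1 else 0
firstChange x _           = 0

countChanges-∷ : ∀ x ys → countChanges (x ∷ ys) ≡ firstChange x ys + countChanges ys
countChanges-∷ x []           = refl
countChanges-∷ x (y ∷ [])     = refl
countChanges-∷ x (y ∷ z ∷ zs) = refl

firstChange-flipFrom : ∀ {k} → 2 ≤ k → ∀ x ys → firstChange x (flipFrom k ys) ≡ firstChange x ys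
firstChange-flipFrom (s≤s (s≤s z≤n)) x []           = refl
firstChange-flipFrom (s≤s (s≤s z≤n)) x (y ∷ [])     = refl
firstChange-flipFrom (s≤s (s≤s z≤n)) x (y ∷ z ∷ zs) = refl

-- For i = 0 both sides collapse by negation invariance; for i > 0 the first test of
-- x ∷ xs sees only the flip at i, because j ≥ 2 leaves the first two entries of xs alone.
countChanges-flipFrom-additive : ∀ {i j} → i + 2 ≤ j → ∀ xs →
  countChanges (flipFrom j (flipFrom i xs)) + countChanges xs
    ≡ countChanges (flipFrom j xs) + countChanges (flipFrom i xs)
countChanges-flipFrom-additive {zero} {j} _ xs =
  cong₂ _+_ (trans (cong countChanges (flipFrom-neg j xs)) (countChanges-neg (flipFrom j xs)))
            (sym (countChanges-neg xs))
countChanges-flipFrom-additive {suc i} {suc j} _ [] = refl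
countChanges-flipFrom-additive {suc i} {suc j} (s≤s i+2≤j) (x ∷ xs) = begin
  cc (x ∷ Fj (Fi xs)) + cc (x ∷ xs)
    ≡⟨ cong₂ _+_ (countChanges-∷ x (Fj (Fi xs))) (countChanges-∷ x xs) ⟩
  (fc (Fj (Fi xs)) + cc (Fj (Fi xs))) + (fc xs + cc xs)
    ≡⟨ cong (λ t → (t + cc (Fj (Fi xs))) + (fc xs + cc xs)) (firstChange-flipFrom 2≤j x (Fi xs)) ⟩
  (fc (Fi xs) + cc (Fj (Fi xs))) + (fc xs + cc xs)
    ≡⟨ interchange (fc (Fi xs)) (cc (Fj (Fi xs))) (fc xs) (cc xs) ⟩
  (fc (Fi xs) + fc xs) + (cc (Fj (Fi xs)) + cc xs)
    ≡⟨ cong₂ _+_ (+-comm (fc (Fi xs)) (fc xs)) (countChanges-flipFrom-additive i+2≤j xs) ⟩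
  (fc xs + fc (Fi xs)) + (cc (Fj xs) + cc (Fi xs))
    ≡⟨ interchange (fc xs) (fc (Fi xs)) (cc (Fj xs)) (cc (Fi xs)) ⟩
  (fc xs + cc (Fj xs)) + (fc (Fi xs) + cc (Fi xs))
    ≡⟨ cong (λ t → (t + cc (Fj xs)) + (fc (Fi xs) + cc (Fi xs))) (sym (firstChange-flipFrom 2≤j x xs)) ⟩
  (fc (Fj xs) + cc (Fj xs)) + (fc (Fi xs) + cc (Fi xs))
    ≡⟨ cong₂ _+_ (countChanges-∷ x (Fj xs)) (countChanges-∷ x (Fi xs)) ⟨
  cc (x ∷ Fj xs) + cc (x ∷ Fi xs) ∎
  where
  open ≡-Reasoning
  cc = countChanges
  fc = firstChange x
  Fi = flipFrom i
  Fj = flipFrom j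
  2≤j : 2 ≤ j
  2≤j = ≤-trans (m≤n+m 2 i) i+2≤j

countChanges-flipFrom-additive′ : ∀ {i j} → i + 2 ≤ j ⊎ j + 2 ≤ i → ∀ xs →
  countChanges (flipFrom j (flipFrom i xs)) + countChanges xs
    ≡ countChanges (flipFrom j xs) + countChanges (flipFrom i xs)
countChanges-flipFrom-additive′ (inj₁ i+2≤j) xs = countChanges-flipFrom-additive i+2≤j xs
countChanges-flipFrom-additive′ {i} {j} (inj₂ j+2≤i) xs = begin
  countChanges (flipFrom j (flipFrom i xs)) + countChanges xs
    ≡⟨ cong (λ ys → countChanges ys + countChanges xs) (flipFrom-comm j i xs) ⟩
  countChanges (flipFrom i (flipFrom j xs)) + countChanges xs
    ≡⟨ countChanges-flipFrom-additive j+2≤i xs ⟩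
  countChanges (flipFrom i xs) + countChanges (flipFrom j xs)
    ≡⟨ +-comm (countChanges (flipFrom i xs)) (countChanges (flipFrom j xs)) ⟩
  countChanges (flipFrom j xs) + countChanges (flipFrom i xs) ∎
  where open ≡-Reasoning

countChanges-flipFrom-increment : ∀ {i j} → i + 2 ≤ j ⊎ j + 2 ≤ i → ∀ xs →
  countChanges (flipFrom i xs) ≡ countChanges xs + 1 →
  countChanges (flipFrom j (flipFrom i xs)) ≡ countChanges (flipFrom j xs) + 1
countChanges-flipFrom-increment {i} {j} apart xs flip-i-adds-one =
  +-cancelʳ-≡ (cc xs) (cc (Fj (Fi xs))) (cc (Fj xs) + 1) (begin
    cc (Fj (Fi xs)) + cc xs     ≡⟨ countChanges-flipFrom-additive′ apart xs ⟩
    cc (Fj xs) + cc (Fi xs)     ≡⟨ cong (cc (Fj xs) +_) flip-i-adds-one ⟩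
    cc (Fj xs) + (cc xs + 1)    ≡⟨ cong (cc (Fj xs) +_) (+-comm (cc xs) 1) ⟩
    cc (Fj xs) + (1 + cc xs)    ≡⟨ +-assoc (cc (Fj xs)) 1 (cc xs) ⟨
    (cc (Fj xs) + 1) + cc xs    ∎)
  where
  open ≡-Reasoning
  cc = countChanges
  Fi = flipFrom i
  Fj = flipFrom j

sameParity-≢⇒apart : ∀ i j → i % 2 ≡ j % 2 → i ≢ j → i + 2 ≤ j ⊎ j + 2 ≤ i
sameParity-≢⇒apart 0 0 _ i≢j = ⊥-elim (i≢j refl)
sameParity-≢⇒apart 1 1 _ i≢j = ⊥-elim (i≢j refl)
sameParity-≢⇒apart 0 1 ()
sameParity-≢⇒apart 1 0 ()
sameParity-≢⇒apart 1 2 ()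
sameParity-≢⇒apart 2 1 ()
sameParity-≢⇒apart 0 (suc (suc j)) _ _ = inj₁ (s≤s (s≤s z≤n))
sameParity-≢⇒apart (suc (suc i)) 0 _ _ = inj₂ (s≤s (s≤s z≤n))
sameParity-≢⇒apart 1 (suc (suc (suc j))) _ _ = inj₁ (s≤s (s≤s (s≤s z≤n)))
sameParity-≢⇒apart (suc (suc (suc i))) 1 _ _ = inj₂ (s≤s (s≤s (s≤s z≤n)))
-- (2 + i) % 2 computes to i % 2, so p is reused as is.
sameParity-≢⇒apart (suc (suc i)) (suc (suc j)) p i≢j =
  Sum.map (s≤s ∘ s≤s) (s≤s ∘ s≤s) (sameParity-≢⇒apart i j p (i≢j ∘ cong (suc ∘ suc)))

lemma8 : (n : ℕ) → 3 ≤ n → (i j : ℕ) → InT n i → InT n j → i ≢ j →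
    (π : List ℤ) → length π ≡ n → IsSignedPerm n π →
    altrunsB (sgnFlip i π) ≡ altrunsB π + 1 →
    altrunsB (sgnFlip j (sgnFlip i π)) ≡ altrunsB (sgnFlip j π) + 1
-- Only i ≡ j (mod 2), i ≢ j and i, j ≥ 1 are needed: π may be any word of integers.
lemma8 n _ (suc i) (suc j) (s≤s _ , _ , i-parity) (s≤s _ , _ , j-parity) i≢j π _ _ flip-i-adds-run =
  cong suc (countChanges-flipFrom-increment apart (0ℤ ∷ π) (suc-injective flip-i-adds-run))
  where
  apart : suc i + 2 ≤ suc j ⊎ suc j + 2 ≤ suc i
  apart = sameParity-≢⇒apart (suc i) (suc j) (trans i-parity (sym j-parity)) i≢j
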